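{- Every multihypergraph $H$ on $k$ vertices satisfies $\chi'(H)\leq\nu(k)\Delta(H)$.
   Context: A multihypergraph has a vertex set and a multiset of edges, each a set of vertices. $\Delta(H)$ is the maximum number of edges containing a vertex; $\chi'(H)$ is the least number of colours in an edge-colouring in which any two intersecting edges receive distinct colours. A hypergraph is intersecting if every two edges share a vertex. A fractional matching of a hypergraph $H$ is $w\colon E(H)\to[0,1]$ with $\sum_{e\ni v}w(e)\leq1$ for every vertex $v$; its size is $\sum_e w(e)$, and $\nu^*(H)$ is the maximum size of a fractional matching. $\nu(k)$ is the maximum of $\nu^*(H)$ over all intersecting hypergraphs $H$ on $k$ vertices. -}

module Defs where

open import Data.Nat as ℕ using (ℕ; zero; suc; _⊔_)
open import Data.Fin using (Fin; zero; suc)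
open import Data.Fin.Subset using (Subset; _∈_; Nonempty)
open import Data.Fin.Subset.Properties using (_∈?_)
open import Data.Integer using (+_)
open import Data.Rational using (ℚ; 0ℚ; 1ℚ; _/_) renaming (_+_ to _+ℚ_; _≤_ to _≤ℚ_)
open import Data.Product using (Σ; ∃; _×_; _,_)
open import Relation.Nullary using (¬_; yes; no)
open import Relation.Binary.PropositionalEquality using (_≡_)

ℕtoℚ : ℕ → ℚ
ℕtoℚ n = + n / 1

sumℕ : ∀ {m} → (Fin m → ℕ) → ℕ
sumℕ {zero}  f = 0
sumℕ {suc m} f = f zero ℕ.+ sumℕ (λ i → f (suc i))

sumℚ : ∀ {m} → (Fin m → ℚ) → ℚ
sumℚ {zero}  f = 0ℚ
sumℚ {suc m} f = f zero +ℚ sumℚ (λ i → f (suc i))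

maxFin : ∀ {k} → (Fin k → ℕ) → ℕ
maxFin {zero}  f = 0
maxFin {suc k} f = f zero ⊔ maxFin (λ i → f (suc i))

-- A multihypergraph on vertex set Fin k: a finite family (multiset) of
-- edges indexed by Fin m; each edge is a (nonempty) subset of the vertices.
record MultiHypergraph (k : ℕ) : Set where
  field
    m        : ℕ
    edge     : Fin m → Subset k
    nonempty : ∀ i → Nonempty (edge i)
open MultiHypergraph public

Intersect : ∀ {k} → Subset k → Subset k → Set
Intersect e f = ∃ λ v → v ∈ e × v ∈ f

degree : ∀ {k} → MultiHypergraph k → Fin k → ℕ
degree H v = sumℕ (λ i → indicator (v ∈? edge H i))
  where
  indicator : ∀ {P : Set} → Relation.Nullary.Dec P → ℕ
  indicator (yes _) = 1
  indicator (no _)  = 0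

Δ : ∀ {k} → MultiHypergraph k → ℕ
Δ H = maxFin (degree H)

ProperEdgeColouring : ∀ {k} → (H : MultiHypergraph k) → (c : ℕ) → (Fin (m H) → Fin c) → Set
ProperEdgeColouring H c col =
  ∀ i j → ¬ (i ≡ j) → Intersect (edge H i) (edge H j) → ¬ (col i ≡ col j)

EdgeColourable : ∀ {k} → MultiHypergraph k → ℕ → Set
EdgeColourable H c = Σ (Fin (m H) → Fin c) (ProperEdgeColouring H c)

IsChromaticIndex : ∀ {k} → MultiHypergraph k → ℕ → Set
IsChromaticIndex H c = EdgeColourable H c × (∀ c' → EdgeColourable H c' → c ℕ.≤ c')

Intersecting : ∀ {k} → MultiHypergraph k → Set
Intersecting H = ∀ i j → Intersect (edge H i) (edge H j)

IsFractionalMatching : ∀ {k} → (H : MultiHypergraph k) → (Fin (m H) → ℚ) → Set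
IsFractionalMatching H w =
  (∀ i → (0ℚ ≤ℚ w i) × (w i ≤ℚ 1ℚ)) ×
  (∀ v → sumℚ (λ i → restrict v i) ≤ℚ 1ℚ)
  where
  restrict : _ → Fin (m H) → ℚ
  restrict v i with v ∈? edge H i
  ... | yes _ = w i
  ... | no _  = 0ℚ

size : ∀ {k} → (H : MultiHypergraph k) → (Fin (m H) → ℚ) → ℚ
size H w = sumℚ w

IsFractionalMatchingNumber : ∀ {k} → MultiHypergraph k → ℚ → Set
IsFractionalMatchingNumber H r =
  (Σ (Fin (m H) → ℚ) λ w → IsFractionalMatching H w × size H w ≡ r) ×
  (∀ w → IsFractionalMatching H w → size H w ≤ℚ r)

IsNu : ℕ → ℚ → Set
IsNu k r =
  (Σ (MultiHypergraph k) λ H → Intersecting H × IsFractionalMatchingNumber H r) ×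
  (∀ (H : MultiHypergraph k) s → Intersecting H → IsFractionalMatchingNumber H s → s ≤ℚ r)

module Submission where

-- Let c = χ'(H) and fix a proper colouring with c colours. The colour classes (unions of the
-- edges of one colour) form an intersecting multihypergraph G on the same k vertices with c
-- edges: two disjoint classes could be merged, and an empty class dropped, contradicting the
-- minimality of c. A vertex lies in at most Δ(H) classes, so the constant weight 1/Δ(H) is a
-- fractional matching of G of size c/Δ(H), whence c/Δ(H) ≤ ν*(G) ≤ ν(k).
--
-- That ν*(G) exists at all (the supremum is attained) is the linear-programming part. It is
-- proved by Fourier–Motzkin elimination: projecting the polyhedron {(w , t) : w feasible,
-- t ≤ f · w} onto t eliminates one variable at a time and leaves finitely many lower and upper
-- bounds on t; a nonempty set of that shape which is bounded above has a greatest element.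

open import Defs
open import Data.Nat using (ℕ)
open import Data.Rational using (ℚ; _≤_; _*_)

open import Algebra.Bundles using (CommutativeRing)
import Algebra.Properties.Semiring.Sum as SemiringSum
open import Data.Bool.Properties using (T-≡)
open import Data.Empty using (⊥-elim)
open import Data.Fin using (Fin; zero; suc; _↑ʳ_; punchOut)
open import Data.Fin.Properties using (_≟_; any?; punchOut-injective)
open import Data.Fin.Subset using (Subset; _∈_; Nonempty)
open import Data.Fin.Subset.Properties using (_∈?_; nonempty?)
import Data.Integer as ℤ
import Data.Integer.Properties as ℤ
open import Data.List using (List; []; _∷_; _++_; map; foldr; tabulate; cartesianProductWith)
import Data.List.Extrema
import Data.List.Membership.Propositional as List
open import Data.List.Membership.Propositional.Properties using (∈-cartesianProductWith⁺)
open import Data.List.Relation.Unary.All as All using (All; []; _∷_)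
import Data.List.Relation.Unary.All.Properties as All
open import Data.Nat using (zero; suc)
import Data.Nat as ℕ
open import Data.Nat.Coprimality using (1-coprimeTo) renaming (sym to coprime-sym)
import Data.Nat.Properties as ℕ
open import Data.Product using (Σ; ∃; _×_; _,_; proj₁; proj₂)
open import Data.Product.Function.NonDependent.Propositional using (_×-⇔_)
open import Data.Rational
  using (0ℚ; 1ℚ; _+_; -_; _-_; _<_; mkℚ; *≤*; 1/_; positive; nonNegative; Positive; NonNegative; NonZero)
import Data.Rational.Properties as ℚ
open import Data.Rational.Solver using (module +-*-Solver)
import Data.Vec as Vec
open import Data.Vec.Functional using (Vector; head; tail; take; drop)
  renaming (_++_ to _++ᵛ_; [] to []ᵛ; _∷_ to _∷ᵛ_)
open import Data.Vec.Functional.Properties using (lookup-++ˡ; lookup-++ʳ)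
open import Data.Vec.Properties using ([]=⇒lookup; lookup⇒[]=; lookup∘tabulate)
open import Function.Base using (_∘_)
open import Function.Bundles using (_⇔_; mk⇔; Equivalence)
open import Function.Properties.Equivalence using () renaming (trans to ⇔-trans; sym to ⇔-sym)
open import Relation.Binary.Bundles using (DecTotalOrder)
open import Relation.Binary.Definitions using (tri<; tri≈; tri>)
open import Relation.Binary.PropositionalEquality
  using (_≡_; _≢_; refl; sym; trans; cong; cong₂; subst; subst₂; _≗_; module ≡-Reasoning)
import Relation.Binary.PropositionalEquality as ≡
open import Relation.Nullary using (¬_; Dec; yes; no)
open import Relation.Nullary.Decidable using (isYes; toWitness; fromWitness; _×-dec_)
open import Relation.Unary using (Pred; Decidable)

open +-*-Solver using (solve; _:=_; _:+_; _:-_; _:*_; :-_; con)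
open SemiringSum (CommutativeRing.semiring ℚ.+-*-commutativeRing)
  using (sum; sum-cong-≗; sum-replicate-zero; ∑-comm; ∑-distrib-+; *-distribˡ-sum; *-distribʳ-sum)
open Data.List.Extrema (DecTotalOrder.totalOrder ℚ.≤-decTotalOrder)
  using (min; max; min≤⊤; min≤xs; v≤min⁺; xs≤max; max≤v⁺)

-- Arithmetic and finite sums over ℚ

≤-by-difference : ∀ {p q p′ q′} → p - q ≡ p′ - q′ → p ≤ q → p′ ≤ q′
≤-by-difference {p} {q} {p′} {q′} eq p≤q = begin
  p′              ≡⟨ split p′ q′ ⟩
  q′ + (p′ - q′)  ≡⟨ cong (q′ +_) eq ⟨
  q′ + (p - q)    ≤⟨ ℚ.+-monoʳ-≤ q′ (ℚ.+-monoˡ-≤ (- q) p≤q) ⟩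
  q′ + (q - q)    ≡⟨ cancel q q′ ⟩
  q′              ∎
  where
  open ℚ.≤-Reasoning
  split : ∀ a b → a ≡ b + (a - b)
  split = solve 2 (λ a b → a := b :+ (a :- b)) refl
  cancel : ∀ a b → b + (a - a) ≡ b
  cancel = solve 2 (λ a b → b :+ (a :- a) := b) refl

≤⇔-by-difference : ∀ {p q p′ q′} → p - q ≡ p′ - q′ → p ≤ q ⇔ p′ ≤ q′
≤⇔-by-difference eq = mk⇔ (≤-by-difference eq) (≤-by-difference (sym eq))

positive-inverse : ∀ {p} → 0ℚ < p → ∃ λ r → 0ℚ < r × p * r ≡ 1ℚ
positive-inverse {p} 0<p = 1/ p , ℚ.positive⁻¹ _ {{ℚ.1/pos⇒pos p}} , ℚ.*-inverseʳ p
  where instance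
  p-positive : Positive p
  p-positive = positive 0<p
  p-nonZero : NonZero p
  p-nonZero = ℚ.pos⇒nonZero p

*-monoˡ-≤-pos : ∀ {r p q} → 0ℚ < r → p ≤ q → r * p ≤ r * q
*-monoˡ-≤-pos {r} 0<r = ℚ.*-monoˡ-≤-nonNeg r {{nonNegative (ℚ.<⇒≤ 0<r)}}

*-cancelˡ-≤-pos : ∀ {r p q} → 0ℚ < r → r * p ≤ r * q → p ≤ q
*-cancelˡ-≤-pos {r} 0<r = ℚ.*-cancelˡ-≤-pos r {{positive 0<r}}

*-nonNeg : ∀ {p q} → 0ℚ ≤ p → 0ℚ ≤ q → 0ℚ ≤ p * q
*-nonNeg {p} {q} 0≤p 0≤q = subst (_≤ p * q) (ℚ.*-zeroʳ p) (ℚ.*-monoˡ-≤-nonNeg p {{nonNegative 0≤p}} 0≤q)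

0≤1 : 0ℚ ≤ 1ℚ
0≤1 = ℚ.<⇒≤ (ℚ.positive⁻¹ 1ℚ)

ℕtoℚ≡mkℚ : ∀ n → ℕtoℚ n ≡ mkℚ (ℤ.+ n) 0 (coprime-sym (1-coprimeTo n))
ℕtoℚ≡mkℚ n = ℚ.normalize-coprime (coprime-sym (1-coprimeTo n))

ℕtoℚ-+ : ∀ a b → ℕtoℚ (a ℕ.+ b) ≡ ℕtoℚ a + ℕtoℚ b
ℕtoℚ-+ a b rewrite ℕtoℚ≡mkℚ a | ℕtoℚ≡mkℚ b | ℕ.*-identityʳ a | ℕ.*-identityʳ b
                  | ℤ.+◃n≡+n a | ℤ.+◃n≡+n b = refl

ℕtoℚ-mono-≤ : ∀ {a b} → a ℕ.≤ b → ℕtoℚ a ≤ ℕtoℚ b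
ℕtoℚ-mono-≤ {a} {b} a≤b rewrite ℕtoℚ≡mkℚ a | ℕtoℚ≡mkℚ b =
  *≤* (subst₂ ℤ._≤_ (sym (ℤ.*-identityʳ (ℤ.+ a))) (sym (ℤ.*-identityʳ (ℤ.+ b))) (ℤ.+≤+ a≤b))

0≤ℕtoℚ : ∀ n → 0ℚ ≤ ℕtoℚ n
0≤ℕtoℚ n = ℕtoℚ-mono-≤ {0} {n} ℕ.z≤n

sumℚ≡sum : ∀ {n} (f : Vector ℚ n) → sumℚ f ≡ sum f
sumℚ≡sum {zero}  f = refl
sumℚ≡sum {suc n} f = cong (f zero +_) (sumℚ≡sum (f ∘ suc))

ℕtoℚ-sumℕ : ∀ {n} (f : Fin n → ℕ) → ℕtoℚ (sumℕ f) ≡ sum (ℕtoℚ ∘ f)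
ℕtoℚ-sumℕ {zero}  f = refl
ℕtoℚ-sumℕ {suc n} f = trans (ℕtoℚ-+ (f zero) (sumℕ (f ∘ suc))) (cong (ℕtoℚ (f zero) +_) (ℕtoℚ-sumℕ (f ∘ suc)))

sum-const : ∀ n x → sum {n} (λ _ → x) ≡ ℕtoℚ n * x
sum-const zero    x = sym (ℚ.*-zeroˡ x)
sum-const (suc n) x = begin
  x + sum {n} (λ _ → x)  ≡⟨ cong (x +_) (sum-const n x) ⟩
  x + ℕtoℚ n * x         ≡⟨ cong (_+ ℕtoℚ n * x) (ℚ.*-identityˡ x) ⟨
  1ℚ * x + ℕtoℚ n * x    ≡⟨ ℚ.*-distribʳ-+ x 1ℚ (ℕtoℚ n) ⟨
  (1ℚ + ℕtoℚ n) * x      ≡⟨ cong (_* x) (ℕtoℚ-+ 1 n) ⟨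
  ℕtoℚ (suc n) * x       ∎
  where open ≡-Reasoning

sum-mono-≤ : ∀ {n} {f g : Vector ℚ n} → (∀ i → f i ≤ g i) → sum f ≤ sum g
sum-mono-≤ {zero}  f≤g = ℚ.≤-refl
sum-mono-≤ {suc n} f≤g = ℚ.+-mono-≤ (f≤g zero) (sum-mono-≤ (f≤g ∘ suc))

sum-nonNeg : ∀ {n} {f : Vector ℚ n} → (∀ i → 0ℚ ≤ f i) → 0ℚ ≤ sum f
sum-nonNeg {n} {f} 0≤f = subst (_≤ sum f) (sum-replicate-zero n) (sum-mono-≤ 0≤f)

term≤sum : ∀ {n} {f : Vector ℚ n} → (∀ i → 0ℚ ≤ f i) → ∀ i → f i ≤ sum f
term≤sum {suc n} {f} 0≤f zero    =
  subst (_≤ sum f) (ℚ.+-identityʳ (f zero)) (ℚ.+-monoʳ-≤ (f zero) (sum-nonNeg (0≤f ∘ suc)))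
term≤sum {suc n} {f} 0≤f (suc i) =
  subst (_≤ sum f) (ℚ.+-identityˡ (f (suc i))) (ℚ.+-mono-≤ (0≤f zero) (term≤sum (0≤f ∘ suc) i))

sum-take-drop : ∀ m {n} (f : Vector ℚ (m ℕ.+ n)) → sum f ≡ sum (take m f) + sum (drop m f)
sum-take-drop zero    f = sym (ℚ.+-identityˡ (sum f))
sum-take-drop (suc m) f = trans (cong (f zero +_) (sum-take-drop m (f ∘ suc))) (sym (ℚ.+-assoc (f zero) _ _))

δ : ∀ {n} → Fin n → Fin n → ℚ
δ zero    zero    = 1ℚ
δ zero    (suc j) = 0ℚ
δ (suc i) zero    = 0ℚ
δ (suc i) (suc j) = δ i j

δ-diag : ∀ {n} (i : Fin n) → δ i i ≡ 1ℚ
δ-diag zero    = refl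
δ-diag (suc i) = δ-diag i

δ-nonNeg : ∀ {n} (i j : Fin n) → 0ℚ ≤ δ i j
δ-nonNeg zero    zero    = 0≤1
δ-nonNeg zero    (suc j) = ℚ.≤-refl
δ-nonNeg (suc i) zero    = ℚ.≤-refl
δ-nonNeg (suc i) (suc j) = δ-nonNeg i j

sum-δ : ∀ {n} (i : Fin n) (x : Vector ℚ n) → sum (λ j → δ i j * x j) ≡ x i
sum-δ {suc n} zero x = begin
  1ℚ * x zero + sum (λ j → 0ℚ * x (suc j))  ≡⟨ cong₂ _+_ (ℚ.*-identityˡ (x zero)) (sum-cong-≗ (λ j → ℚ.*-zeroˡ (x (suc j)))) ⟩
  x zero + sum {n} (λ _ → 0ℚ)               ≡⟨ cong (x zero +_) (sum-replicate-zero n) ⟩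
  x zero + 0ℚ                               ≡⟨ ℚ.+-identityʳ (x zero) ⟩
  x zero                                    ∎
  where open ≡-Reasoning
sum-δ (suc i) x = trans (cong₂ _+_ (ℚ.*-zeroˡ (x zero)) (sum-δ i (x ∘ suc))) (ℚ.+-identityˡ (x (suc i)))

infix 7 _·_

_·_ : ∀ {n} → Vector ℚ n → Vector ℚ n → ℚ
a · x = sum (λ i → a i * x i)

·-congˡ : ∀ {n} {a b : Vector ℚ n} x → a ≗ b → a · x ≡ b · x
·-congˡ x a≗b = sum-cong-≗ (λ i → cong (_* x i) (a≗b i))

·-congʳ : ∀ {n} (a : Vector ℚ n) {x y} → x ≗ y → a · x ≡ a · y
·-congʳ a x≗y = sum-cong-≗ (λ i → cong (a i *_) (x≗y i))

·-distribʳ-+ : ∀ {n} (a b x : Vector ℚ n) → (λ i → a i + b i) · x ≡ a · x + b · x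
·-distribʳ-+ a b x =
  trans (sum-cong-≗ (λ i → ℚ.*-distribʳ-+ (x i) (a i) (b i))) (∑-distrib-+ (λ i → a i * x i) (λ i → b i * x i))

·-scaleˡ : ∀ {n} r (a x : Vector ℚ n) → (λ i → r * a i) · x ≡ r * (a · x)
·-scaleˡ r a x = trans (sum-cong-≗ (λ i → ℚ.*-assoc r (a i) (x i))) (sym (*-distribˡ-sum r (λ i → a i * x i)))

·-negˡ : ∀ {n} (a x : Vector ℚ n) → (λ i → - a i) · x ≡ - (a · x)
·-negˡ a x = begin
  (λ i → - a i) · x       ≡⟨ ·-congˡ x (λ i → -1*p≡-p (a i)) ⟨
  (λ i → - 1ℚ * a i) · x  ≡⟨ ·-scaleˡ (- 1ℚ) a x ⟩
  - 1ℚ * (a · x)          ≡⟨ -1*p≡-p (a · x) ⟩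
  - (a · x)               ∎
  where
  open ≡-Reasoning
  -1*p≡-p : ∀ p → - 1ℚ * p ≡ - p
  -1*p≡-p = solve 1 (λ p → :- con 1ℚ :* p := :- p) refl

·-++ : ∀ {m n} (a : Vector ℚ m) (b : Vector ℚ n) x → (a ++ᵛ b) · x ≡ a · take m x + b · drop m x
·-++ {m} {n} a b x = begin
  sum ax                             ≡⟨ sum-take-drop m ax ⟩
  sum (take m ax) + sum (drop m ax)  ≡⟨ cong₂ _+_ (sum-cong-≗ (λ i → cong (_* take m x i) (lookup-++ˡ a b i)))
                                                  (sum-cong-≗ (λ i → cong (_* drop m x i) (lookup-++ʳ a b i))) ⟩
  a · take m x + b · drop m x        ∎
  where
  open ≡-Reasoning
  ax : Vector ℚ (m ℕ.+ n)
  ax i = (a ++ᵛ b) i * x i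

-- Fourier–Motzkin elimination

Between : List ℚ → List ℚ → ℚ → Set
Between ls us t = All (_≤ t) ls × All (t ≤_) us

between-nonempty : ∀ {ls us} → All (λ l → All (l ≤_) us) ls → ∃ (Between ls us)
between-nonempty {ls} {us} l≤u = t , xs≤max default ls , All.tabulate t≤u
  where
  default t : ℚ
  default = min 0ℚ us
  t = max default ls
  t≤u : ∀ {u} → u List.∈ us → t ≤ u
  t≤u u∈us = max≤v⁺ (All.lookup (min≤xs 0ℚ us) u∈us) (All.map (λ l≤us → All.lookup l≤us u∈us) l≤u)

between-maximum : ∀ {ls us t₀ B} → Between ls us t₀ → (∀ {t} → Between ls us t → t ≤ B) →
                  ∃ λ t* → Between ls us t* × (∀ {t} → Between ls us t → t ≤ t*)
between-maximum {us = []} {t₀} {B} (ls≤t₀ , []) bounded =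
  ⊥-elim (ℚ.<-irrefl refl (ℚ.<-≤-trans B<B+1 (bounded (All.map (λ l≤t₀ → ℚ.≤-trans l≤t₀ t₀≤B+1) ls≤t₀ , []))))
  where
  B<B+1 : B < B + 1ℚ
  B<B+1 = subst (_< B + 1ℚ) (ℚ.+-identityʳ B) (ℚ.+-monoʳ-< B (ℚ.positive⁻¹ 1ℚ))
  t₀≤B+1 : t₀ ≤ B + 1ℚ
  t₀≤B+1 = ℚ.≤-trans (bounded (ls≤t₀ , [])) (ℚ.<⇒≤ B<B+1)
between-maximum {us = u ∷ us} (ls≤t₀ , t₀≤u ∷ t₀≤us) _ =
  min u us , (All.map (λ l≤t₀ → ℚ.≤-trans l≤t₀ (v≤min⁺ t₀≤u t₀≤us)) ls≤t₀ , min≤⊤ u us ∷ min≤xs u us) ,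
  λ { (_ , t≤u ∷ t≤us) → v≤min⁺ t≤u t≤us }

infix 5 _·x≤_
infix 4 _satisfies_ _⊨_

record LinearConstraint (n : ℕ) : Set where
  constructor _·x≤_
  field
    coeffs : Vector ℚ n
    bound  : ℚ

_satisfies_ : ∀ {n} → Vector ℚ n → LinearConstraint n → Set
x satisfies (a ·x≤ c) = a · x ≤ c

_⊨_ : ∀ {n} → Vector ℚ n → List (LinearConstraint n) → Set
x ⊨ S = All (x satisfies_) S

⊨-cong : ∀ {n} {x y : Vector ℚ n} {S} → x ≗ y → x ⊨ S → y ⊨ S
⊨-cong x≗y = All.map (λ {(a ·x≤ c)} → subst (_≤ c) (·-congʳ a x≗y))

scale : ∀ {n} → ℚ → LinearConstraint n → LinearConstraint n
scale r (a ·x≤ c) = (λ i → r * a i) ·x≤ r * c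

scale-⇔ : ∀ {n r} {x : Vector ℚ n} k → 0ℚ < r → x satisfies k ⇔ x satisfies scale r k
scale-⇔ {r = r} {x} (a ·x≤ c) 0<r = mk⇔
  (λ a·x≤c → subst (_≤ r * c) (sym (·-scaleˡ r a x)) (*-monoˡ-≤-pos 0<r a·x≤c))
  (λ ra·x≤rc → *-cancelˡ-≤-pos 0<r (subst (_≤ r * c) (·-scaleˡ r a x) ra·x≤rc))

dropHead : ∀ {n} → LinearConstraint (suc n) → LinearConstraint n
dropHead (a ·x≤ c) = tail a ·x≤ c

upperValue lowerValue : ∀ {n} → Vector ℚ n → LinearConstraint n → ℚ
upperValue y (a ·x≤ c) = c - a · y
lowerValue y (a ·x≤ c) = a · y - c

data Bound (n : ℕ) : Set where
  free upper lower : LinearConstraint n → Bound n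

BoundHolds : ∀ {n} → ℚ → Vector ℚ n → Bound n → Set
BoundHolds x₀ y (free k)  = y satisfies k
BoundHolds x₀ y (upper k) = x₀ ≤ upperValue y k
BoundHolds x₀ y (lower k) = lowerValue y k ≤ x₀

module _ {n} {x : Vector ℚ (suc n)} (k : LinearConstraint (suc n)) where
  open LinearConstraint k renaming (coeffs to a; bound to c)
  private
    A : ℚ
    A = tail a · tail x

  head-zero-⇔ : head a ≡ 0ℚ → x satisfies k ⇔ tail x satisfies dropHead k
  head-zero-⇔ a₀≡0 = ≤⇔-by-difference (trans (cong (λ a₀ → a₀ * head x + A - c) a₀≡0) (identity (head x) A c))
    where
    identity : ∀ x₀ p q → 0ℚ * x₀ + p - q ≡ p - q
    identity = solve 3 (λ x₀ p q → con 0ℚ :* x₀ :+ p :- q := p :- q) refl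

  head-one-⇔ : head a ≡ 1ℚ → x satisfies k ⇔ head x ≤ upperValue (tail x) (dropHead k)
  head-one-⇔ a₀≡1 = ≤⇔-by-difference (trans (cong (λ a₀ → a₀ * head x + A - c) a₀≡1) (identity (head x) A c))
    where
    identity : ∀ x₀ p q → 1ℚ * x₀ + p - q ≡ x₀ - (q - p)
    identity = solve 3 (λ x₀ p q → con 1ℚ :* x₀ :+ p :- q := x₀ :- (q :- p)) refl

  head-minus-one-⇔ : head a ≡ - 1ℚ → x satisfies k ⇔ lowerValue (tail x) (dropHead k) ≤ head x
  head-minus-one-⇔ a₀≡-1 = ≤⇔-by-difference (trans (cong (λ a₀ → a₀ * head x + A - c) a₀≡-1) (identity (head x) A c))
    where
    identity : ∀ x₀ p q → - 1ℚ * x₀ + p - q ≡ (p - q) - x₀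
    identity = solve 3 (λ x₀ p q → :- con 1ℚ :* x₀ :+ p :- q := (p :- q) :- x₀) refl

-- Dividing by |a₀| makes the coefficient of the first variable 0 or ±1.
classify : ∀ {n} → LinearConstraint (suc n) → Bound n
classify k@(a ·x≤ _) with ℚ.<-cmp (head a) 0ℚ
... | tri< a₀<0 _ _ = lower (dropHead (scale (proj₁ (positive-inverse (ℚ.neg-antimono-< a₀<0))) k))
... | tri≈ _ _ _    = free (dropHead k)
... | tri> _ _ 0<a₀ = upper (dropHead (scale (proj₁ (positive-inverse 0<a₀)) k))

classify-⇔ : ∀ {n} {x : Vector ℚ (suc n)} k → x satisfies k ⇔ BoundHolds (head x) (tail x) (classify k)
classify-⇔ {x = x} k@(a ·x≤ _) with ℚ.<-cmp (head a) 0ℚ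
... | tri< a₀<0 _ _ =
  let (r , 0<r , -a₀r≡1) = positive-inverse (ℚ.neg-antimono-< a₀<0)
  in ⇔-trans (scale-⇔ {x = x} k 0<r)
             (head-minus-one-⇔ {x = x} (scale r k) (trans (identity (head a) r) (cong -_ -a₀r≡1)))
  where
  identity : ∀ a₀ r → r * a₀ ≡ - (- a₀ * r)
  identity = solve 2 (λ a₀ r → r :* a₀ := :- (:- a₀ :* r)) refl
... | tri≈ _ a₀≡0 _ = head-zero-⇔ {x = x} k a₀≡0
... | tri> _ _ 0<a₀ =
  let (r , 0<r , a₀r≡1) = positive-inverse 0<a₀
  in ⇔-trans (scale-⇔ {x = x} k 0<r) (head-one-⇔ {x = x} (scale r k) (trans (ℚ.*-comm r (head a)) a₀r≡1))

record Bounds (n : ℕ) : Set where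
  constructor bounds
  field
    frees uppers lowers : List (LinearConstraint n)

addBound : ∀ {n} → Bound n → Bounds n → Bounds n
addBound (free k)  (bounds fs us ls) = bounds (k ∷ fs) us ls
addBound (upper k) (bounds fs us ls) = bounds fs (k ∷ us) ls
addBound (lower k) (bounds fs us ls) = bounds fs us (k ∷ ls)

partition : ∀ {n} → List (LinearConstraint (suc n)) → Bounds n
partition = foldr (addBound ∘ classify) (bounds [] [] [])

BoundsHold : ∀ {n} → ℚ → Vector ℚ n → Bounds n → Set
BoundsHold x₀ y (bounds fs us ls) = y ⊨ fs × Between (map (lowerValue y) ls) (map (upperValue y) us) x₀

addBound-⇔ : ∀ {n x₀} {y : Vector ℚ n} b B →
             (BoundHolds x₀ y b × BoundsHold x₀ y B) ⇔ BoundsHold x₀ y (addBound b B)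
addBound-⇔ (free k)  (bounds fs us ls) =
  mk⇔ (λ (p , ps , ls≤ , ≤us) → p ∷ ps , ls≤ , ≤us) (λ { (p ∷ ps , ls≤ , ≤us) → p , ps , ls≤ , ≤us })
addBound-⇔ (upper k) (bounds fs us ls) =
  mk⇔ (λ (p , ps , ls≤ , ≤us) → ps , ls≤ , p ∷ ≤us) (λ { (ps , ls≤ , p ∷ ≤us) → p , ps , ls≤ , ≤us })
addBound-⇔ (lower k) (bounds fs us ls) =
  mk⇔ (λ (p , ps , ls≤ , ≤us) → ps , p ∷ ls≤ , ≤us) (λ { (ps , p ∷ ls≤ , ≤us) → p , ps , ls≤ , ≤us })

partition-⇔ : ∀ {n} {x : Vector ℚ (suc n)} S → x ⊨ S ⇔ BoundsHold (head x) (tail x) (partition S)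
partition-⇔ []              = mk⇔ (λ _ → [] , [] , []) (λ _ → [])
partition-⇔ {x = x} (k ∷ S) =
  ⇔-trans (mk⇔ (λ { (p ∷ ps) → p , ps }) (λ (p , ps) → p ∷ ps))
    (⇔-trans (classify-⇔ {x = x} k ×-⇔ partition-⇔ {x = x} S) (addBound-⇔ (classify k) (partition S)))

combine : ∀ {n} → LinearConstraint n → LinearConstraint n → LinearConstraint n
combine (a ·x≤ c) (a′ ·x≤ c′) = (λ i → a i + a′ i) ·x≤ c + c′

combine-⇔ : ∀ {n} {y : Vector ℚ n} u l → y satisfies combine u l ⇔ lowerValue y l ≤ upperValue y u
combine-⇔ {y = y} (a ·x≤ c) (a′ ·x≤ c′) =
  ≤⇔-by-difference (trans (cong (_- (c + c′)) (·-distribʳ-+ a a′ y)) (identity (a · y) (a′ · y) c c′))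
  where
  identity : ∀ p p′ q q′ → p + p′ - (q + q′) ≡ (p′ - q′) - (q - p)
  identity = solve 4 (λ p p′ q q′ → p :+ p′ :- (q :+ q′) := (p′ :- q′) :- (q :- p)) refl

eliminate : ∀ {n} → List (LinearConstraint (suc n)) → List (LinearConstraint n)
eliminate S = frees ++ cartesianProductWith combine uppers lowers
  where open Bounds (partition S)

eliminate-sound : ∀ {n} {x : Vector ℚ (suc n)} S → x ⊨ S → tail x ⊨ eliminate S
eliminate-sound {x = x} S x⊨S =
  All.++⁺ (proj₁ holds) (All.cartesianProductWith⁺ (≡.setoid _) (≡.setoid _) combine uppers lowers pair-holds)
  where
  open Bounds (partition S)
  holds : BoundsHold (head x) (tail x) (partition S)
  holds = Equivalence.to (partition-⇔ {x = x} S) x⊨S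
  pair-holds : ∀ {u l} → u List.∈ uppers → l List.∈ lowers → tail x satisfies combine u l
  pair-holds {u} {l} u∈us l∈ls = Equivalence.from (combine-⇔ u l)
    (ℚ.≤-trans (All.lookup (All.map⁻ (proj₁ (proj₂ holds))) l∈ls) (All.lookup (All.map⁻ (proj₂ (proj₂ holds))) u∈us))

eliminate-complete : ∀ {n} {y : Vector ℚ n} S → y ⊨ eliminate S → ∃ λ x₀ → (x₀ ∷ᵛ y) ⊨ S
eliminate-complete {y = y} S y⊨ =
  let (x₀ , between) = between-nonempty (All.map⁺ (All.tabulate λ l∈ls → All.map⁺ (All.tabulate λ u∈us → pair l∈ls u∈us)))
  in x₀ , Equivalence.from (partition-⇔ {x = x₀ ∷ᵛ y} S) (All.++⁻ˡ frees y⊨ , between)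
  where
  open Bounds (partition S)
  pair : ∀ {l u} → l List.∈ lowers → u List.∈ uppers → lowerValue y l ≤ upperValue y u
  pair {l} {u} l∈ls u∈us =
    Equivalence.to (combine-⇔ u l) (All.lookup (All.++⁻ʳ frees y⊨) (∈-cartesianProductWith⁺ combine u∈us l∈ls))

project : ∀ m {n} → List (LinearConstraint (m ℕ.+ n)) → List (LinearConstraint n)
project zero    S = S
project (suc m) S = project m (eliminate S)

project-sound : ∀ m {n} {x : Vector ℚ (m ℕ.+ n)} S → x ⊨ S → drop m x ⊨ project m S
project-sound zero            S x⊨S = x⊨S
project-sound (suc m) {x = x} S x⊨S = project-sound m (eliminate S) (eliminate-sound {x = x} S x⊨S)

project-complete : ∀ m {n} {y : Vector ℚ n} S → y ⊨ project m S → ∃ λ x → x ⊨ S × drop m x ≡ y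
project-complete zero    {y = y} S y⊨ = y , y⊨ , refl
project-complete (suc m) S y⊨ =
  let (x , x⊨ , drop≡y) = project-complete m (eliminate S) y⊨
      (x₀ , x₀∷x⊨S)     = eliminate-complete S x⊨
  in x₀ ∷ᵛ x , x₀∷x⊨S , drop≡y

extend : ∀ {n} → LinearConstraint n → LinearConstraint (n ℕ.+ 1)
extend (a ·x≤ c) = (a ++ᵛ (0ℚ ∷ᵛ []ᵛ)) ·x≤ c

extend-⇔ : ∀ {n} {x : Vector ℚ (n ℕ.+ 1)} k → x satisfies extend k ⇔ take n x satisfies k
extend-⇔ {n} {x} (a ·x≤ c) = mk⇔ (subst (_≤ c) a·x≡) (subst (_≤ c) (sym a·x≡))
  where
  identity : ∀ p t → p + (0ℚ * t + 0ℚ) ≡ p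
  identity = solve 2 (λ p t → p :+ (con 0ℚ :* t :+ con 0ℚ) := p) refl
  a·x≡ : (a ++ᵛ (0ℚ ∷ᵛ []ᵛ)) · x ≡ a · take n x
  a·x≡ = trans (·-++ a _ x) (identity (a · take n x) (x (n ↑ʳ zero)))

belowObjective : ∀ {n} → Vector ℚ n → LinearConstraint (n ℕ.+ 1)
belowObjective f = ((λ i → - f i) ++ᵛ (1ℚ ∷ᵛ []ᵛ)) ·x≤ 0ℚ

hypograph : ∀ {n} → Vector ℚ n → List (LinearConstraint n) → List (LinearConstraint (n ℕ.+ 1))
hypograph f S = belowObjective f ∷ map extend S

hypograph-⇔ : ∀ {n} {x : Vector ℚ (n ℕ.+ 1)} f S →
              x ⊨ hypograph f S ⇔ (take n x ⊨ S × x (n ↑ʳ zero) ≤ f · take n x)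
hypograph-⇔ {n} {x} f S = mk⇔
  (λ { (below ∷ ext) → All.map (λ {k} → Equivalence.to (extend-⇔ {x = x} k)) (All.map⁻ ext) ,
                       Equivalence.to below-⇔ below })
  (λ (x⊨S , t≤fx) → Equivalence.from below-⇔ t≤fx ∷ All.map⁺ (All.map (λ {k} → Equivalence.from (extend-⇔ {x = x} k)) x⊨S))
  where
  identity : ∀ p t → (- p + (1ℚ * t + 0ℚ)) - 0ℚ ≡ t - p
  identity = solve 2 (λ p t → (:- p :+ (con 1ℚ :* t :+ con 0ℚ)) :- con 0ℚ := t :- p) refl
  below-⇔ : x satisfies belowObjective f ⇔ x (n ↑ʳ zero) ≤ f · take n x
  below-⇔ = ≤⇔-by-difference
    (trans (cong (_- 0ℚ) (trans (·-++ (λ i → - f i) (1ℚ ∷ᵛ []ᵛ) x) (cong (_+ _) (·-negˡ f (take n x)))))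
           (identity (f · take n x) (x (n ↑ʳ zero))))

hypograph-projection-⇔ : ∀ {n} (f : Vector ℚ n) S {t} →
                         (∃ λ x → x ⊨ S × t ≤ f · x) ⇔ (t ∷ᵛ []ᵛ) ⊨ project n (hypograph f S)
hypograph-projection-⇔ {n} f S {t} = mk⇔ to from
  where
  to : (∃ λ x → x ⊨ S × t ≤ f · x) → (t ∷ᵛ []ᵛ) ⊨ project n (hypograph f S)
  to (x , x⊨S , t≤fx) =
    ⊨-cong {x = drop n z} {y = t ∷ᵛ []ᵛ} (λ { zero → lookup-++ʳ x (t ∷ᵛ []ᵛ) zero })
           (project-sound n {x = z} (hypograph f S) z⊨)
    where
    z : Vector ℚ (n ℕ.+ 1)
    z = x ++ᵛ (t ∷ᵛ []ᵛ)
    x≗take : x ≗ take n z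
    x≗take i = sym (lookup-++ˡ x (t ∷ᵛ []ᵛ) i)
    z⊨ : z ⊨ hypograph f S
    z⊨ = Equivalence.from (hypograph-⇔ {x = z} f S)
      (⊨-cong x≗take x⊨S , subst₂ _≤_ (sym (lookup-++ʳ x (t ∷ᵛ []ᵛ) zero)) (·-congʳ f x≗take) t≤fx)
  from : (t ∷ᵛ []ᵛ) ⊨ project n (hypograph f S) → ∃ λ x → x ⊨ S × t ≤ f · x
  from t⊨ =
    let (z , z⊨ , drop≡t)  = project-complete n {y = t ∷ᵛ []ᵛ} (hypograph f S) t⊨
        (take⊨S , last≤) = Equivalence.to (hypograph-⇔ {x = z} f S) z⊨
    in take n z , take⊨S , subst (_≤ f · take n z) (cong head drop≡t) last≤

-- Once every variable but t is eliminated the bounds are constants: the free ones hold because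
-- x₀ is feasible, and the others cut out an interval of values of t.
linear-program-maximum : ∀ {n} (S : List (LinearConstraint n)) (f : Vector ℚ n) {B} →
                         ∃ (_⊨ S) → (∀ {x} → x ⊨ S → f · x ≤ B) →
                         ∃ λ x* → x* ⊨ S × (∀ {x} → x ⊨ S → f · x ≤ f · x*)
linear-program-maximum S f {B} (x₀ , x₀⊨S) bounded =
  let (t* , t*-feasible , t*-maximal) = between-maximum (value-feasible x₀⊨S) feasible-bounded
      (x* , x*⊨S , t*≤fx*)             = realise t*-feasible
  in x* , x*⊨S , λ x⊨S → ℚ.≤-trans (t*-maximal (value-feasible x⊨S)) t*≤fx*
  where
  P : List (LinearConstraint 1)
  P = project _ (hypograph f S)
  open Bounds (partition P)
  feasible-⇔ : ∀ {t} → (∃ λ x → x ⊨ S × t ≤ f · x) ⇔ BoundsHold t []ᵛ (partition P)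
  feasible-⇔ {t} = ⇔-trans (hypograph-projection-⇔ f S) (partition-⇔ {x = t ∷ᵛ []ᵛ} P)
  Feasible : ℚ → Set
  Feasible = Between (map (lowerValue []ᵛ) lowers) (map (upperValue []ᵛ) uppers)
  value-feasible : ∀ {x} → x ⊨ S → Feasible (f · x)
  value-feasible x⊨S = proj₂ (Equivalence.to feasible-⇔ (_ , x⊨S , ℚ.≤-refl))
  realise : ∀ {t} → Feasible t → ∃ λ x → x ⊨ S × t ≤ f · x
  realise t-feasible =
    Equivalence.from feasible-⇔ (proj₁ (Equivalence.to feasible-⇔ (x₀ , x₀⊨S , ℚ.≤-refl)) , t-feasible)
  feasible-bounded : ∀ {t} → Feasible t → t ≤ B
  feasible-bounded t-feasible = let (x , x⊨S , t≤fx) = realise t-feasible in ℚ.≤-trans t≤fx (bounded x⊨S)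

-- Fractional matchings as a linear program

indicator : ∀ {P : Set} → Dec P → ℚ
indicator (yes _) = 1ℚ
indicator (no _)  = 0ℚ

indicator-nonNeg : ∀ {P : Set} (d : Dec P) → 0ℚ ≤ indicator d
indicator-nonNeg (yes _) = 0≤1
indicator-nonNeg (no _)  = ℚ.≤-refl

incidence : ∀ {k} (G : MultiHypergraph k) → Fin k → Vector ℚ (m G)
incidence G v i = indicator (v ∈? edge G i)

incidence-∈ : ∀ {k} (G : MultiHypergraph k) {v i} → v ∈ edge G i → incidence G v i ≡ 1ℚ
incidence-∈ G {v} {i} v∈ with v ∈? edge G i
... | yes _  = refl
... | no v∉ = ⊥-elim (v∉ v∈)

InUnitCube : ∀ {n} → Vector ℚ n → Set
InUnitCube w = ∀ i → (0ℚ ≤ w i) × (w i ≤ 1ℚ)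

-- IsFractionalMatching and degree keep their summands in `where` blocks; matching a Σ-type
-- against refl gives those summands a name.
private
  vertexLoads : ∀ {k} (G : MultiHypergraph k) w → Σ (Fin k → Fin (m G) → ℚ) λ load →
                IsFractionalMatching G w ≡ (InUnitCube w × ∀ v → sumℚ (load v) ≤ 1ℚ)
  vertexLoads G w = _ , refl

  vertexLoad≡ : ∀ {k} (G : MultiHypergraph k) w v i → proj₁ (vertexLoads G w) v i ≡ incidence G v i * w i
  vertexLoad≡ G w v i with v ∈? edge G i
  ... | yes _ = sym (ℚ.*-identityˡ (w i))
  ... | no _  = sym (ℚ.*-zeroˡ (w i))

  degreeTerms : ∀ {k} (H : MultiHypergraph k) v → Σ (Fin (m H) → ℕ) λ t → degree H v ≡ sumℕ t
  degreeTerms H v = _ , refl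

  degreeTerm≡ : ∀ {k} (H : MultiHypergraph k) v i → ℕtoℚ (proj₁ (degreeTerms H v) i) ≡ incidence H v i
  degreeTerm≡ H v i with v ∈? edge H i
  ... | yes _ = refl
  ... | no _  = refl

isFractionalMatching-⇔ : ∀ {k} (G : MultiHypergraph k) w →
                         IsFractionalMatching G w ⇔ (InUnitCube w × ∀ v → incidence G v · w ≤ 1ℚ)
isFractionalMatching-⇔ G w =
  mk⇔ (λ (w∈cube , loads≤1) → w∈cube , λ v → subst (_≤ 1ℚ) (load≡ v) (loads≤1 v))
      (λ (w∈cube , loads≤1) → w∈cube , λ v → subst (_≤ 1ℚ) (sym (load≡ v)) (loads≤1 v))
  where
  load≡ : ∀ v → sumℚ (proj₁ (vertexLoads G w) v) ≡ incidence G v · w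
  load≡ v = trans (sumℚ≡sum (proj₁ (vertexLoads G w) v)) (sum-cong-≗ (vertexLoad≡ G w v))

degree≡sum-incidence : ∀ {k} (H : MultiHypergraph k) v → ℕtoℚ (degree H v) ≡ sum (incidence H v)
degree≡sum-incidence H v = trans (ℕtoℚ-sumℕ (proj₁ (degreeTerms H v))) (sum-cong-≗ (degreeTerm≡ H v))

≤-maxFin : ∀ {n} (f : Fin n → ℕ) i → f i ℕ.≤ maxFin f
≤-maxFin f zero    = ℕ.m≤m⊔n (f zero) _
≤-maxFin f (suc i) = ℕ.≤-trans (≤-maxFin (f ∘ suc) i) (ℕ.m≤n⊔m (f zero) _)

degree≤Δ : ∀ {k} (H : MultiHypergraph k) v → sum (incidence H v) ≤ ℕtoℚ (Δ H)
degree≤Δ H v = subst (_≤ ℕtoℚ (Δ H)) (degree≡sum-incidence H v) (ℕtoℚ-mono-≤ (≤-maxFin (degree H) v))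

edge⇒1≤Δ : ∀ {k} (H : MultiHypergraph k) → Fin (m H) → 1ℚ ≤ ℕtoℚ (Δ H)
edge⇒1≤Δ H i =
  let (v , v∈i) = nonempty H i
  in ℚ.≤-trans (ℚ.≤-reflexive (sym (incidence-∈ H v∈i)))
               (ℚ.≤-trans (term≤sum (λ i → indicator-nonNeg (v ∈? edge H i)) i) (degree≤Δ H v))

nonNegativity atMostOne : ∀ {n} → List (LinearConstraint n)
nonNegativity = tabulate (λ i → (λ j → - δ i j) ·x≤ 0ℚ)
atMostOne     = tabulate (λ i → δ i ·x≤ 1ℚ)

vertexCapacities : ∀ {k} (G : MultiHypergraph k) → List (LinearConstraint (m G))
vertexCapacities G = tabulate (λ v → incidence G v ·x≤ 1ℚ)

fractionalMatchingConstraints : ∀ {k} (G : MultiHypergraph k) → List (LinearConstraint (m G))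
fractionalMatchingConstraints G = nonNegativity ++ atMostOne ++ vertexCapacities G

⊨-fractionalMatching-⇔ : ∀ {k} (G : MultiHypergraph k) w →
                         w ⊨ fractionalMatchingConstraints G ⇔ IsFractionalMatching G w
⊨-fractionalMatching-⇔ G w = ⇔-trans (mk⇔ to from) (⇔-sym (isFractionalMatching-⇔ G w))
  where
  identity : ∀ p → - p - 0ℚ ≡ 0ℚ - p
  identity = solve 1 (λ p → :- p :- con 0ℚ := con 0ℚ :- p) refl
  nonNeg-⇔ : ∀ i → w satisfies (λ j → - δ i j) ·x≤ 0ℚ ⇔ 0ℚ ≤ w i
  nonNeg-⇔ i = ≤⇔-by-difference (trans (cong (_- 0ℚ) (trans (·-negˡ (δ i) w) (cong -_ (sum-δ i w)))) (identity (w i)))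
  atMostOne-⇔ : ∀ i → w satisfies δ i ·x≤ 1ℚ ⇔ w i ≤ 1ℚ
  atMostOne-⇔ i = mk⇔ (subst (_≤ 1ℚ) (sum-δ i w)) (subst (_≤ 1ℚ) (sym (sum-δ i w)))
  to : w ⊨ fractionalMatchingConstraints G → InUnitCube w × ∀ v → incidence G v · w ≤ 1ℚ
  to w⊨ =
    let rest = All.++⁻ʳ nonNegativity w⊨
    in (λ i → Equivalence.to (nonNeg-⇔ i) (All.tabulate⁻ (All.++⁻ˡ nonNegativity w⊨) i) ,
              Equivalence.to (atMostOne-⇔ i) (All.tabulate⁻ (All.++⁻ˡ atMostOne rest) i)) ,
       All.tabulate⁻ (All.++⁻ʳ atMostOne rest)
  from : InUnitCube w × (∀ v → incidence G v · w ≤ 1ℚ) → w ⊨ fractionalMatchingConstraints G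
  from (w∈cube , loads≤1) =
    All.++⁺ (All.tabulate⁺ (λ i → Equivalence.from (nonNeg-⇔ i) (proj₁ (w∈cube i))))
            (All.++⁺ (All.tabulate⁺ (λ i → Equivalence.from (atMostOne-⇔ i) (proj₂ (w∈cube i))))
                     (All.tabulate⁺ loads≤1))

fractionalMatchingNumber-exists : ∀ {k} (G : MultiHypergraph k) → ∃ (IsFractionalMatchingNumber G)
fractionalMatchingNumber-exists G =
  let (w* , w*⊨ , maximal) = linear-program-maximum (fractionalMatchingConstraints G) (λ _ → 1ℚ)
                               (_ , Equivalence.from (⊨-fractionalMatching-⇔ G _) zero-matching) size-bounded
  in size G w* , (w* , Equivalence.to (⊨-fractionalMatching-⇔ G w*) w*⊨ , refl) ,
     λ w fm → subst₂ _≤_ (size≡ w) (size≡ w*) (maximal (Equivalence.from (⊨-fractionalMatching-⇔ G w) fm))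
  where
  size≡ : ∀ w → (λ _ → 1ℚ) · w ≡ size G w
  size≡ w = trans (sum-cong-≗ (λ i → ℚ.*-identityˡ (w i))) (sym (sumℚ≡sum w))
  zero-matching : IsFractionalMatching G (λ _ → 0ℚ)
  zero-matching = Equivalence.from (isFractionalMatching-⇔ G _)
    ((λ _ → ℚ.≤-refl , 0≤1) ,
     λ v → subst (_≤ 1ℚ) (sym (trans (sum-cong-≗ (λ i → ℚ.*-zeroʳ (incidence G v i))) (sum-replicate-zero (m G)))) 0≤1)
  size-bounded : ∀ {w} → w ⊨ fractionalMatchingConstraints G → (λ _ → 1ℚ) · w ≤ sum {m G} (λ _ → 1ℚ)
  size-bounded {w} w⊨ =
    let (w∈cube , _) = Equivalence.to (isFractionalMatching-⇔ G w) (Equivalence.to (⊨-fractionalMatching-⇔ G w) w⊨)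
    in sum-mono-≤ (λ i → subst (_≤ 1ℚ) (sym (ℚ.*-identityˡ (w i))) (proj₂ (w∈cube i)))

constant-fractionalMatching : ∀ {k} (G : MultiHypergraph k) {D r} → 0ℚ ≤ r → 1ℚ ≤ D → D * r ≡ 1ℚ →
                              (∀ v → sum (incidence G v) ≤ D) →
                              IsFractionalMatching G (λ _ → r) × size G (λ _ → r) * D ≡ ℕtoℚ (m G)
constant-fractionalMatching G {D} {r} 0≤r 1≤D Dr≡1 degree≤D =
  Equivalence.from (isFractionalMatching-⇔ G (λ _ → r)) ((λ _ → 0≤r , r≤1) , load≤1) , size·D≡m
  where
  instance
    r-nonNeg : NonNegative r
    r-nonNeg = nonNegative 0≤r
  r≤1 : r ≤ 1ℚ
  r≤1 = subst₂ _≤_ (ℚ.*-identityˡ r) Dr≡1 (ℚ.*-monoʳ-≤-nonNeg r 1≤D)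
  load≤1 : ∀ v → incidence G v · (λ _ → r) ≤ 1ℚ
  load≤1 v = subst₂ _≤_ (*-distribʳ-sum r (incidence G v)) Dr≡1 (ℚ.*-monoʳ-≤-nonNeg r (degree≤D v))
  reassociate : ∀ a b d → a * b * d ≡ a * (d * b)
  reassociate = solve 3 (λ a b d → a :* b :* d := a :* (d :* b)) refl
  open ≡-Reasoning
  size·D≡m : sumℚ {m G} (λ _ → r) * D ≡ ℕtoℚ (m G)
  size·D≡m = begin
    sumℚ {m G} (λ _ → r) * D  ≡⟨ cong (_* D) (trans (sumℚ≡sum {m G} (λ _ → r)) (sum-const (m G) r)) ⟩
    ℕtoℚ (m G) * r * D        ≡⟨ reassociate (ℕtoℚ (m G)) r D ⟩
    ℕtoℚ (m G) * (D * r)      ≡⟨ cong (ℕtoℚ (m G) *_) Dr≡1 ⟩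
    ℕtoℚ (m G) * 1ℚ           ≡⟨ ℚ.*-identityʳ (ℕtoℚ (m G)) ⟩
    ℕtoℚ (m G)                ∎

-- Colour classes of a minimal colouring

subsetOf : ∀ {n p} {P : Pred (Fin n) p} → Decidable P → Subset n
subsetOf P? = Vec.tabulate (isYes ∘ P?)

∈-subsetOf⇔ : ∀ {n p} {P : Pred (Fin n) p} (P? : Decidable P) {x} → x ∈ subsetOf P? ⇔ P x
∈-subsetOf⇔ P? {x} = mk⇔
  (λ x∈ → toWitness (Equivalence.from T-≡ (trans (sym (lookup∘tabulate (isYes ∘ P?) x)) ([]=⇒lookup x∈))))
  (λ Px → lookup⇒[]= x _ (trans (lookup∘tabulate (isYes ∘ P?) x) (Equivalence.to T-≡ (fromWitness Px))))

intersect? : ∀ {n} (A B : Subset n) → Dec (Intersect A B)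
intersect? A B = any? (λ v → (v ∈? A) ×-dec (v ∈? B))

module _ {k} (H : MultiHypergraph k) {c} (col : Fin (m H) → Fin c) where

  colourClass : Fin c → Subset k
  colourClass j = subsetOf (λ v → any? (λ i → (col i ≟ j) ×-dec (v ∈? edge H i)))

  ∈-colourClass⇔ : ∀ {j v} → v ∈ colourClass j ⇔ ∃ λ i → col i ≡ j × v ∈ edge H i
  ∈-colourClass⇔ = ∈-subsetOf⇔ _

  edge⊆colourClass : ∀ {i j v} → col i ≡ j → v ∈ edge H i → v ∈ colourClass j
  edge⊆colourClass {i} ci≡j v∈ = Equivalence.from ∈-colourClass⇔ (i , ci≡j , v∈)

  repaint : Fin c → Fin c → Fin (m H) → Fin c
  repaint j j′ i with col i ≟ j′
  ... | yes _ = j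
  ... | no _  = col i

  repaint-proper : ∀ {j j′} → ProperEdgeColouring H c col → ¬ Intersect (colourClass j) (colourClass j′) →
                   ProperEdgeColouring H c (repaint j j′)
  repaint-proper {j′ = j′} proper disjoint i i′ i≢i′ ∩@(v , v∈i , v∈i′) with col i ≟ j′ | col i′ ≟ j′
  ... | yes ci≡j′ | yes ci′≡j′ = λ _ → proper i i′ i≢i′ ∩ (trans ci≡j′ (sym ci′≡j′))
  ... | yes ci≡j′ | no _       = λ j≡ci′ → disjoint (v , edge⊆colourClass (sym j≡ci′) v∈i′ , edge⊆colourClass ci≡j′ v∈i)
  ... | no _       | yes ci′≡j′ = λ ci≡j → disjoint (v , edge⊆colourClass ci≡j v∈i , edge⊆colourClass ci′≡j′ v∈i′)
  ... | no _       | no _       = proper i i′ i≢i′ ∩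

  repaint-avoids : ∀ {j j′} → j ≢ j′ → ∀ i → repaint j j′ i ≢ j′
  repaint-avoids {j′ = j′} j≢j′ i with col i ≟ j′
  ... | yes _    = j≢j′
  ... | no ci≢j′ = ci≢j′

  classCount≤degree : ∀ v → sum (λ j → indicator (v ∈? colourClass j)) ≤ sum (incidence H v)
  classCount≤degree v = begin
    sum (λ j → indicator (v ∈? colourClass j))             ≤⟨ sum-mono-≤ class≤edges ⟩
    sum (λ j → sum (λ i → δ (col i) j * incidence H v i))  ≡⟨ ∑-comm (λ i j → δ (col i) j * incidence H v i) ⟨
    sum (λ i → sum (λ j → δ (col i) j * incidence H v i))  ≡⟨ sum-cong-≗ (λ i → sum-δ (col i) (λ _ → incidence H v i)) ⟩
    sum (incidence H v)                                    ∎
    where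
    open ℚ.≤-Reasoning
    terms-nonNeg : ∀ j i → 0ℚ ≤ δ (col i) j * incidence H v i
    terms-nonNeg j i = *-nonNeg (δ-nonNeg (col i) j) (indicator-nonNeg (v ∈? edge H i))
    class≤edges : ∀ j → indicator (v ∈? colourClass j) ≤ sum (λ i → δ (col i) j * incidence H v i)
    class≤edges j with v ∈? colourClass j
    ... | no _   = sum-nonNeg (terms-nonNeg j)
    ... | yes v∈ =
      let (i , ci≡j , v∈i) = Equivalence.to ∈-colourClass⇔ v∈
          term≡1 = cong₂ _*_ (trans (cong (λ j′ → δ j′ j) ci≡j) (δ-diag j)) (incidence-∈ H v∈i)
      in subst (_≤ _) term≡1 (term≤sum (terms-nonNeg j) i)

drop-unused-colour : ∀ {k} (H : MultiHypergraph k) {c} (col : Fin (m H) → Fin (suc c)) {j} →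
                     ProperEdgeColouring H (suc c) col → (∀ i → col i ≢ j) → EdgeColourable H c
drop-unused-colour H col proper unused =
  (λ i → punchOut (unused i ∘ sym)) ,
  λ i i′ i≢i′ ∩ same → proper i i′ i≢i′ ∩ (punchOut-injective (unused i ∘ sym) (unused i′ ∘ sym) same)

minimal-classes-intersect : ∀ {k} (H : MultiHypergraph k) {c} (col : Fin (m H) → Fin c) →
                            ProperEdgeColouring H c col → (∀ c′ → EdgeColourable H c′ → c ℕ.≤ c′) →
                            ∀ j j′ → j ≢ j′ → Intersect (colourClass H col j) (colourClass H col j′)
minimal-classes-intersect H {suc c} col proper minimal j j′ j≢j′
  with intersect? (colourClass H col j) (colourClass H col j′)
... | yes ∩       = ∩
... | no disjoint = ⊥-elim (ℕ.<-irrefl refl (minimal c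
      (drop-unused-colour H (repaint H col j j′) (repaint-proper H col proper disjoint) (repaint-avoids H col j≢j′))))

minimal-class-nonempty : ∀ {k} (H : MultiHypergraph k) {c} (col : Fin (m H) → Fin c) →
                         ProperEdgeColouring H c col → (∀ c′ → EdgeColourable H c′ → c ℕ.≤ c′) →
                         ∀ j → Nonempty (colourClass H col j)
minimal-class-nonempty H {suc c} col proper minimal j with nonempty? (colourClass H col j)
... | yes nonempty = nonempty
... | no empty     = ⊥-elim (ℕ.<-irrefl refl (minimal c (drop-unused-colour H col proper unused)))
  where
  unused : ∀ i → col i ≢ j
  unused i ci≡j = empty (proj₁ (nonempty H i) , edge⊆colourClass H col ci≡j (proj₂ (nonempty H i)))

module _ {k} (H : MultiHypergraph k) {c} (χ : IsChromaticIndex H c) where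
  private
    col : Fin (m H) → Fin c
    col = proj₁ (proj₁ χ)

  classHypergraph : MultiHypergraph k
  classHypergraph = record
    { m = c ; edge = colourClass H col ; nonempty = minimal-class-nonempty H col (proj₂ (proj₁ χ)) (proj₂ χ) }

  classHypergraph-intersecting : Intersecting classHypergraph
  classHypergraph-intersecting j j′ with j ≟ j′
  ... | yes refl = let (v , v∈) = nonempty classHypergraph j in v , v∈ , v∈
  ... | no j≢j′  = minimal-classes-intersect H col (proj₂ (proj₁ χ)) (proj₂ χ) j j′ j≢j′

  classHypergraph-degree≤Δ : ∀ v → sum (incidence classHypergraph v) ≤ ℕtoℚ (Δ H)
  classHypergraph-degree≤Δ v = ℚ.≤-trans (classCount≤degree H col v) (degree≤Δ H v)

  colour-used : ∀ j → ∃ λ i → col i ≡ j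
  colour-used j =
    let (i , ci≡j , _) = Equivalence.to (∈-colourClass⇔ H col) (proj₂ (nonempty classHypergraph j)) in i , ci≡j

chromaticIndex≤ν*·Δ : ∀ {k} {H : MultiHypergraph k} {c s} (χ : IsChromaticIndex H c) →
                      IsFractionalMatchingNumber (classHypergraph H χ) s → ℕtoℚ c ≤ s * ℕtoℚ (Δ H)
-- With no colours the class hypergraph has no edges, so s is an empty sum.
chromaticIndex≤ν*·Δ {H = H} {c = zero} χ ((_ , _ , size≡s) , _) =
  subst (λ s → 0ℚ ≤ s * ℕtoℚ (Δ H)) size≡s (ℚ.≤-reflexive (sym (ℚ.*-zeroˡ (ℕtoℚ (Δ H)))))
chromaticIndex≤ν*·Δ {H = H} {c = suc c} {s} χ (_ , maximal) =
  let (r , 0<r , Δr≡1)  = positive-inverse (ℚ.<-≤-trans (ℚ.positive⁻¹ 1ℚ) 1≤Δ)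
      (uniform , size·Δ≡c) = constant-fractionalMatching (classHypergraph H χ) (ℚ.<⇒≤ 0<r) 1≤Δ Δr≡1
                               (classHypergraph-degree≤Δ H χ)
  in subst (_≤ s * ℕtoℚ (Δ H)) size·Δ≡c
           (ℚ.*-monoʳ-≤-nonNeg (ℕtoℚ (Δ H)) {{nonNegative (0≤ℕtoℚ (Δ H))}} (maximal _ uniform))
  where
  1≤Δ : 1ℚ ≤ ℕtoℚ (Δ H)
  1≤Δ = edge⇒1≤Δ H (proj₁ (colour-used H χ zero))

lemma2p6 : (k : ℕ) (H : MultiHypergraph k) (χ' : ℕ) (ν : ℚ) →
             IsChromaticIndex H χ' → IsNu k ν →
             ℕtoℚ χ' ≤ ν * ℕtoℚ (Δ H)
lemma2p6 k H χ' ν χ (_ , ν-maximal) =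
  let G             = classHypergraph H χ
      (s , s-is-ν*) = fractionalMatchingNumber-exists G
      s≤ν           = ν-maximal G s (classHypergraph-intersecting H χ) s-is-ν*
  in ℚ.≤-trans (chromaticIndex≤ν*·Δ χ s-is-ν*)
               (ℚ.*-monoʳ-≤-nonNeg (ℕtoℚ (Δ H)) {{nonNegative (0≤ℕtoℚ (Δ H))}} s≤ν)
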